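{- Let $r>0$ be an integer, $a=r$ and $b=(2r)^r$. Let $\Pi=(X,\Sigma,\Phi)$ be a 2CSP instance and consider its $(a,b)$-bipartite direct product. Let $u$ be an $r$-sized multi-assignment for $\binom{X}{a}$ and $v$ a $1$-sized assignment for $\binom{X}{b}$ (i.e. $v(T)$ is a single partial satisfying assignment for each $T\in\binom{X}{b}$). Suppose that for every $S\in\binom{X}{a}$ and $T\in\binom{X}{b}$ with $S\subseteq T$, we have $v(T)_{|S}\in u(S)$. Then there is an assignment $\sigma$ of $X$ satisfying all constraints of $\Pi$.
   Context: A 2CSP instance $\Pi=(X,\Sigma,\Phi)$ consists of a finite set of variables $X$, a domain $\Sigma_x$ for each $x\in X$, and constraints, each a pair of distinct variables with a binary relation on their domains; an assignment satisfies a constraint if its pair of values lies in the relation. For $m\ge1$, $\binom{X}{m}$ denotes the set of $m$-element subsets of $X$. A partial satisfying assignment for $S\subseteq X$ is a function giving each $x\in S$ a value in $\Sigma_x$ such that every constraint of $\Pi$ whose two variables both lie in $S$ is satisfied. The $(a,b)$-bipartite direct product of $\Pi$ has variables $\binom{X}{a}$ (left) and $\binom{X}{b}$ (right), the domain of each variable $S$ being the set of partial satisfying assignments for $S$, with a constraint between every $S\in\binom{X}{a}$ and $T\in\binom{X}{b}$ requiring agreement on $S\cap T$. A $p$-sized multi-assignment for $\binom{X}{m}$ maps each $S\in\binom{X}{m}$ to a set $u(S)$ of at most $p$ partial satisfying assignments for $S$. For an assignment $g$ to $T$ and $S\subseteq T$, $g_{|S}$ is its restriction to $S$. -}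

module Defs where

open import Data.Nat using (ℕ; _+_; _^_; _*_)
open import Data.Fin using (Fin)
open import Data.Bool using (Bool; true; false; T; if_then_else_)
open import Data.List using (List; map; allFin)
open import Data.Nat.ListAction using (sum)
open import Data.List.Relation.Unary.All using (All)
open import Data.Product using (Σ)
open import Relation.Binary.PropositionalEquality using (_≢_)

record Constraint (n : ℕ) (d : Fin n → ℕ) : Set where
  field
    x   : Fin n
    y   : Fin n
    x≢y : x ≢ y
    R   : Fin (d x) → Fin (d y) → Bool
open Constraint public

record CSP (n : ℕ) : Set where
  field
    dom  : Fin n → ℕ
    cons : List (Constraint n dom)
open CSP public

Dom : ∀ {n} → CSP n → Fin n → Set
Dom Π x = Fin (dom Π x)

Sub : ℕ → Set
Sub n = Fin n → Bool

_∈_ : ∀ {n} → Fin n → Sub n → Set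
x ∈ S = T (S x)

_⊆_ : ∀ {n} → Sub n → Sub n → Set
S ⊆ U = ∀ x → x ∈ S → x ∈ U

size : ∀ {n} → Sub n → ℕ
size {n} S = sum (map (λ x → if S x then 1 else 0) (allFin n))

PAssign : ∀ {n} → CSP n → Sub n → Set
PAssign Π S = (x : _) → x ∈ S → Dom Π x

PSatisfies : ∀ {n} (Π : CSP n) (S : Sub n) → PAssign Π S → Set
PSatisfies Π S f =
  All (λ c → (p : x c ∈ S) (q : y c ∈ S) → T (R c (f (x c) p) (f (y c) q))) (cons Π)

PSA : ∀ {n} → CSP n → Sub n → Set
PSA Π S = Σ (PAssign Π S) (PSatisfies Π S)

restrict : ∀ {n} (Π : CSP n) {S U : Sub n} → S ⊆ U → PAssign Π U → PAssign Π S
restrict Π S⊆U g x p = g x (S⊆U x p)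

Satisfies : ∀ {n} (Π : CSP n) → ((x : Fin n) → Dom Π x) → Set
Satisfies Π σ = All (λ c → T (R c (σ (x c)) (σ (y c)))) (cons Π)

-- Track a set A of variables and an assignment α (relevant only on A), with k = r − |A|, under two
-- invariants: (density) every set B of at most level k variables fits, together with A, into a right
-- vertex U whose label v(U) agrees with α on A; (scarcity) every left vertex S ⊇ A has at most k
-- labels in u(S) agreeing with α on A.  If some z ∉ A has two values c₁ ≠ c₂ that both keep A ∪ {z}
-- dense one level lower, set z := c₁: for S ⊇ A ∪ {z}, a right vertex U ⊇ S agreeing with z := c₂
-- exhibits a label of u(S) that agrees with α but not with z := c₁, so scarcity holds with k − 1.
-- Otherwise every z is pinned: fix S ⊇ A ∪ {z}; the candidates for z are the at most k values at z
-- of agreeing labels of u(S); all but one value c fail density through a small set, and every right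
-- vertex containing A, S and these sets, and agreeing with α on A, gives z the value c.  Covering the
-- pinning sets of x and y shows that these values satisfy every constraint on x, y.  At k = 0
-- scarcity contradicts density, since u(A) contains v(U) restricted to A.  The argument is classical,
-- so it runs in the double-negation monad; satisfiability of a finite instance is decidable, which
-- gives back the conclusion.

module Submission where

open import Defs
open import Data.Nat using (ℕ; zero; suc; _≤_; _<_; _^_; _*_; _+_; _∸_; z≤n; s≤s; _≤?_; NonZero)
open import Data.Nat.Properties hiding (_≟_)
open import Algebra.Properties.CommutativeSemigroup +-commutativeSemigroup using () renaming (interchange to +-interchange)
open import Data.Fin using (Fin; zero; suc; _≟_)
open import Data.Fin.Properties using (any?; all?)
open import Data.Bool using (Bool; true; false; T; _∨_; _∧_; not; if_then_else_)
open import Data.Bool.Properties using (T-∨; T-∧; T-irrelevant)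
open import Data.List using (List; []; _∷_; length; map; filter; allFin)
open import Data.List.Properties using (map-tabulate; map-cong; length-map; length-filter; filter-some)
open import Data.Nat.ListAction using (sum)
open import Data.List.Relation.Unary.Any using (Any; here; there)
import Data.List.Relation.Unary.Any as Any
import Data.List.Relation.Unary.All as All
open import Data.List.Membership.Propositional using (find) renaming (_∈_ to _∈ˡ_)
open import Data.List.Membership.Propositional.Properties using (∈-map⁺; ∈-filter⁺)
open import Data.Product using (Σ; ∃; proj₁; proj₂; _×_; _,_)
open import Data.Sum using (_⊎_; inj₁; inj₂; [_,_]′)
open import Data.Empty using (⊥-elim)
open import Data.Unit using (tt)
open import Data.Vec.Functional using (updateAt)
open import Data.Vec.Functional.Properties using (updateAt-updates; updateAt-minimal)
open import Effect.Monad using (RawMonad)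
open import Function using (_∘_; Equivalence)
open import Level using (0ℓ)
open import Relation.Nullary using (¬_; Dec; yes; no)
open import Relation.Nullary.Negation using (¬¬-Monad; ¬¬-map)
open import Relation.Nullary.Decidable using (map′; ¬¬-excluded-middle; decidable-stable; T?)
open import Relation.Unary using (Decidable)
open import Relation.Binary.PropositionalEquality hiding ([_])

open RawMonad (¬¬-Monad {0ℓ})

sum-map-≤ : ∀ {A : Set} {f g : A → ℕ} → (∀ x → f x ≤ g x) → ∀ xs → sum (map f xs) ≤ sum (map g xs)
sum-map-≤ f≤g []       = z≤n
sum-map-≤ f≤g (x ∷ xs) = +-mono-≤ (f≤g x) (sum-map-≤ f≤g xs)

sum-map-+ : ∀ {A : Set} (f g : A → ℕ) xs → sum (map (λ x → f x + g x) xs) ≡ sum (map f xs) + sum (map g xs)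
sum-map-+ f g []       = refl
sum-map-+ f g (x ∷ xs) = trans (cong (f x + g x +_) (sum-map-+ f g xs)) (+-interchange (f x) (g x) _ _)

module _ {A : Set} {P Q : A → Set} (P? : Decidable P) (Q? : Decidable Q) (P⇒Q : ∀ {x} → P x → Q x) where

  length-filter-mono : ∀ xs → length (filter P? xs) ≤ length (filter Q? xs)
  length-filter-mono [] = z≤n
  length-filter-mono (x ∷ xs) with P? x | Q? x
  ... | yes _  | yes _  = s≤s (length-filter-mono xs)
  ... | yes px | no ¬qx = ⊥-elim (¬qx (P⇒Q px))
  ... | no _   | yes _  = m≤n⇒m≤1+n (length-filter-mono xs)
  ... | no _   | no _   = length-filter-mono xs

  length-filter-< : ∀ {xs} → Any (λ x → Q x × ¬ P x) xs → length (filter P? xs) < length (filter Q? xs)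
  length-filter-< {x ∷ xs} (here (qx , ¬px)) with P? x | Q? x
  ... | yes px | _      = ⊥-elim (¬px px)
  ... | no _   | yes _  = s≤s (length-filter-mono xs)
  ... | no _   | no ¬qx = ⊥-elim (¬qx qx)
  length-filter-< {x ∷ xs} (there any) with P? x | Q? x
  ... | yes _  | yes _  = s≤s (length-filter-< any)
  ... | yes px | no ¬qx = ⊥-elim (¬qx (P⇒Q px))
  ... | no _   | yes _  = m≤n⇒m≤1+n (length-filter-< any)
  ... | no _   | no _   = length-filter-< any

¬¬-pull : ∀ {n} {P : Fin n → Set} → (∀ x → ¬ ¬ P x) → ¬ ¬ (∀ x → P x)
¬¬-pull {zero}  _  = pure λ ()
¬¬-pull {suc n} ¬¬P = do
  p₀ ← ¬¬P zero
  ps ← ¬¬-pull (¬¬P ∘ suc)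
  pure λ { zero → p₀ ; (suc x) → ps x }

¬¬-all-but-one : ∀ {X : Set} {D : X → Set} → X → (∀ {c₁ c₂} → c₁ ≢ c₂ → D c₁ → ¬ D c₂)
  → ¬ ¬ Σ X λ c₀ → ∀ c → c ≢ c₀ → ¬ D c
¬¬-all-but-one {X} {D} x₀ unique = ¬¬-map choose ¬¬-excluded-middle
  where
  choose : Dec (∃ D) → Σ X λ c₀ → ∀ c → c ≢ c₀ → ¬ D c
  choose (yes (c₀ , d₀)) = c₀ , λ c c≢c₀ d → unique c≢c₀ d d₀
  choose (no ¬∃D)        = x₀ , λ c _ d → ¬∃D (c , d)

∀-T? : ∀ b {P : T b → Set} → (∀ p → Dec (P p)) → Dec (∀ p → P p)
∀-T? true  P? = map′ (λ p _ → p) (λ ∀P → ∀P tt) (P? tt)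
∀-T? false _  = yes λ ()

infixr 5 _∷ᵈ_
_∷ᵈ_ : ∀ {n} {d : Fin (suc n) → ℕ} → Fin (d zero) → ((x : Fin n) → Fin (d (suc x))) → (x : Fin (suc n)) → Fin (d x)
(a ∷ᵈ f) zero    = a
(a ∷ᵈ f) (suc x) = f x

Π-any? : ∀ {n} (d : Fin n → ℕ) {P : ((x : Fin n) → Fin (d x)) → Set}
  → (∀ {f g} → (∀ x → f x ≡ g x) → P f → P g) → (∀ f → Dec (P f)) → Dec (∃ P)
Π-any? {zero} d P-resp P? = map′ (empty ,_) (λ (f , p) → P-resp (λ ()) p) (P? empty)
  where
  empty : (x : Fin 0) → Fin (d x)
  empty ()
Π-any? {suc n} d {P} P-resp P? = map′
  (λ (a , f , p) → a ∷ᵈ f , p)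
  (λ (f , p) → f zero , f ∘ suc , P-resp (λ { zero → refl ; (suc x) → refl }) p)
  (any? λ a → Π-any? (d ∘ suc) (λ f≗g → P-resp λ { zero → refl ; (suc x) → f≗g x }) (λ f → P? (a ∷ᵈ f)))

satisfies-resp : ∀ {n} (Π : CSP n) {σ τ : (x : Fin n) → Dom Π x} → (∀ x → σ x ≡ τ x) → Satisfies Π σ → Satisfies Π τ
satisfies-resp Π σ≗τ = All.map λ {c} → subst₂ (λ a a' → T (R c a a')) (σ≗τ (x c)) (σ≗τ (y c))

satisfiable? : ∀ {n} (Π : CSP n) → Dec (Σ ((x : Fin n) → Dom Π x) (Satisfies Π))
satisfiable? Π = Π-any? (dom Π) (satisfies-resp Π) λ σ → All.all? (λ c → T? _) (cons Π)

∅ : ∀ {n} → Sub n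
∅ _ = false

infixl 30 _∪_ _─_
_∪_ : ∀ {n} → Sub n → Sub n → Sub n
(S ∪ U) x = S x ∨ U x

_─_ : ∀ {n} → Sub n → Sub n → Sub n
(S ─ A) x = S x ∧ not (A x)

insert : ∀ {n} → Fin n → Sub n → Sub n
insert z A = updateAt A z (λ _ → true)

indicator : Bool → ℕ
indicator b = if b then 1 else 0

size-suc : ∀ {n} (S : Sub (suc n)) → size S ≡ indicator (S zero) + size (S ∘ suc)
size-suc {n} S = cong (λ xs → indicator (S zero) + sum xs)
  (trans (map-tabulate suc (indicator ∘ S)) (sym (map-tabulate (λ x → x) (indicator ∘ S ∘ suc))))

indicator-∉ : ∀ {b} → ¬ T b → indicator b ≡ 0
indicator-∉ {false} _  = refl
indicator-∉ {true}  ¬t = ⊥-elim (¬t tt)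

size-∅ : ∀ {n} → size {n} ∅ ≡ 0
size-∅ {zero}  = refl
size-∅ {suc n} = trans (size-suc (∅ {suc n})) (size-∅ {n})

size-∅-≤ : ∀ {n m} → size (∅ {n}) ≤ m
size-∅-≤ {n} = ≤-trans (≤-reflexive (size-∅ {n})) z≤n

size-∪ : ∀ {n} (S U : Sub n) → size (S ∪ U) ≤ size S + size U
size-∪ {n} S U = ≤-trans (sum-map-≤ (λ x → indicator-∨ (S x) (U x)) (allFin n))
                         (≤-reflexive (sum-map-+ (indicator ∘ S) (indicator ∘ U) (allFin n)))
  where
  indicator-∨ : ∀ a b → indicator (a ∨ b) ≤ indicator a + indicator b
  indicator-∨ true  b = s≤s z≤n
  indicator-∨ false b = ≤-refl

size-─ : ∀ {n} {S A : Sub n} → A ⊆ S → size (S ─ A) + size A ≡ size S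
size-─ {n} {S} {A} A⊆S = begin
  size (S ─ A) + size A                                   ≡⟨ sum-map-+ (indicator ∘ (S ─ A)) (indicator ∘ A) (allFin n) ⟨
  sum (map (λ x → indicator ((S ─ A) x) + indicator (A x)) (allFin n)) ≡⟨ cong sum (map-cong (λ x → indicator-─ (S x) (A x) (A⊆S x)) (allFin n)) ⟩
  size S                                                  ∎
  where
  open ≡-Reasoning
  indicator-─ : ∀ s a → (T a → T s) → indicator (s ∧ not a) + indicator a ≡ indicator s
  indicator-─ true  true  _   = refl
  indicator-─ true  false _   = refl
  indicator-─ false true  a⇒s = ⊥-elim (a⇒s tt)
  indicator-─ false false _   = refl

size-─≡ : ∀ {n} (S A : Sub n) {k} → A ⊆ S → size A + k ≡ size S → size (S ─ A) ≡ k
size-─≡ S A {k} A⊆S |A|+k≡|S| = +-cancelʳ-≡ (size A) _ _ (trans (size-─ A⊆S) (trans (sym |A|+k≡|S|) (+-comm (size A) k)))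

size-insert : ∀ {n} (z : Fin n) (A : Sub n) → ¬ z ∈ A → size (insert z A) ≡ suc (size A)
size-insert {suc n} zero A z∉A = begin
  size (insert zero A)                 ≡⟨ size-suc (insert zero A) ⟩
  suc (size (A ∘ suc))                 ≡⟨ cong (λ m → suc (m + size (A ∘ suc))) (indicator-∉ z∉A) ⟨
  suc (indicator (A zero) + size (A ∘ suc)) ≡⟨ cong suc (size-suc A) ⟨
  suc (size A)                         ∎
  where open ≡-Reasoning
size-insert {suc n} (suc z) A z∉A = begin
  size (insert (suc z) A)                         ≡⟨ size-suc (insert (suc z) A) ⟩
  indicator (A zero) + size (insert z (A ∘ suc))  ≡⟨ cong (indicator (A zero) +_) (size-insert z (A ∘ suc) z∉A) ⟩
  indicator (A zero) + suc (size (A ∘ suc))       ≡⟨ +-suc (indicator (A zero)) _ ⟩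
  suc (indicator (A zero) + size (A ∘ suc))       ≡⟨ cong suc (size-suc A) ⟨
  suc (size A)                                    ∎
  where open ≡-Reasoning

∈-insert : ∀ {n} (z : Fin n) (A : Sub n) → z ∈ insert z A
∈-insert z A = subst T (sym (updateAt-updates z A)) tt

⊆-insert : ∀ {n} (z : Fin n) (A : Sub n) → A ⊆ insert z A
⊆-insert z A w w∈A with w ≟ z
... | yes refl = ∈-insert z A
... | no w≢z   = subst T (sym (updateAt-minimal w z A w≢z)) w∈A

insert⁻ : ∀ {n} (z : Fin n) (A : Sub n) {w} → w ∈ insert z A → w ∈ A ⊎ w ≡ z
insert⁻ z A {w} w∈ with w ≟ z
... | yes w≡z = inj₂ w≡z
... | no w≢z  = inj₁ (subst T (updateAt-minimal w z A w≢z) w∈)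

insert-⊆ : ∀ {n} {z : Fin n} {A U : Sub n} → A ⊆ U → z ∈ U → insert z A ⊆ U
insert-⊆ {z = z} {A} A⊆U z∈U w w∈ = [ A⊆U w , (λ { refl → z∈U }) ]′ (insert⁻ z A w∈)

⊆-∪ˡ : ∀ {n} (S U : Sub n) → S ⊆ S ∪ U
⊆-∪ˡ S U x x∈S = Equivalence.from T-∨ (inj₁ x∈S)

⊆-∪ʳ : ∀ {n} (S U : Sub n) → U ⊆ S ∪ U
⊆-∪ʳ S U x x∈U = Equivalence.from T-∨ (inj₂ x∈U)

─-⊆ : ∀ {n} {S A U : Sub n} → A ⊆ U → S ─ A ⊆ U → S ⊆ U
─-⊆ {S = S} {A} A⊆U S─A⊆U x x∈S with A x in eq
... | true  = A⊆U x (subst T (sym eq) tt)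
... | false = S─A⊆U x (Equivalence.from T-∧ (x∈S , subst (T ∘ not) (sym eq) tt))

∃-∉ : ∀ {n} (A : Sub n) → size A < n → ∃ λ z → ¬ z ∈ A
∃-∉ {suc n} A |A|<n with A zero in eq | subst (_< suc n) (size-suc A) |A|<n
... | false | _         = zero , subst T eq
... | true  | 1+|A'|<n = let z , z∉A = ∃-∉ (A ∘ suc) (≤-pred 1+|A'|<n) in suc z , z∉A

superset : ∀ {n} (A : Sub n) {k} → size A ≤ k → k ≤ n → Σ (Sub n) λ S → A ⊆ S × size S ≡ k
superset A {k} |A|≤k k≤n = grow A (k ∸ size A) (m+[n∸m]≡n |A|≤k)
  where
  grow : ∀ A g → size A + g ≡ k → Σ (Sub _) λ S → A ⊆ S × size S ≡ k
  grow A zero    |A|+0≡k = A , (λ _ x∈A → x∈A) , trans (sym (+-identityʳ _)) |A|+0≡k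
  grow A (suc g) |A|+g≡k =
    let z , z∉A        = ∃-∉ A (≤-trans (m<m+n (size A) (s≤s z≤n)) (≤-trans (≤-reflexive |A|+g≡k) k≤n))
        S , A'⊆S , |S| = grow (insert z A) g (trans (cong (_+ g) (size-insert z A z∉A)) (trans (sym (+-suc (size A) g)) |A|+g≡k))
    in S , (λ x x∈A → A'⊆S x (⊆-insert z A x x∈A)) , |S|

∪-witnesses : ∀ {n} {X : Set} {Q : X → Sub n → Set} → (∀ {c F F'} → F ⊆ F' → Q c F → Q c F')
  → ∀ m (L : List X) → (∀ {c} → c ∈ˡ L → ¬ ¬ Σ (Sub n) λ F → size F ≤ m × Q c F)
  → ¬ ¬ Σ (Sub n) λ F → size F ≤ length L * m × (∀ {c} → c ∈ˡ L → Q c F)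
∪-witnesses {n} Q-mono m [] _ = pure (∅ , size-∅-≤ {n} , λ ())
∪-witnesses Q-mono m (c ∷ L) witness = do
  F₁ , |F₁| , q₁ ← witness (here refl)
  F₂ , |F₂| , q₂ ← ∪-witnesses Q-mono m L (witness ∘ there)
  pure (F₁ ∪ F₂ , ≤-trans (size-∪ F₁ F₂) (+-mono-≤ |F₁| |F₂|)
       , λ { (here refl) → Q-mono (⊆-∪ˡ F₁ F₂) q₁ ; (there c∈L) → Q-mono (⊆-∪ʳ F₁ F₂) (q₂ c∈L) })

-- A pinning set consists of S ─ A (k + 1 variables) and one obstruction of size level k for each of
-- at most k + 1 candidate values; density one level up must cover two pinning sets at once.
level : ℕ → ℕ
level zero    = 0
level (suc k) = 2 * (suc k * suc (level k))

≤-level : ∀ k → k ≤ level k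
≤-level zero    = z≤n
≤-level (suc k) = ≤-trans (m≤m*n (suc k) (suc (level k))) (m≤n*m _ 2)

level-bound : ∀ k → level k ≤ (2 * k) ^ k
level-bound zero    = z≤n
level-bound (suc k) = begin
  2 * (suc k * suc (level k)) ≡⟨ *-assoc 2 (suc k) _ ⟨
  2 * suc k * suc (level k)   ≤⟨ *-monoʳ-≤ (2 * suc k) (level<[2+2k]^k k) ⟩
  (2 * suc k) ^ suc k         ∎
  where
  open ≤-Reasoning
  level<[2+2k]^k : ∀ k → level k < (2 * suc k) ^ k
  level<[2+2k]^k zero    = s≤s z≤n
  level<[2+2k]^k (suc k) = ≤-<-trans (level-bound (suc k)) (^-monoˡ-< (suc k) (*-monoʳ-< 2 (n<1+n (suc k))))

module Descent {n : ℕ} (Π : CSP n) (r b : ℕ)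
  (u : (S : Sub n) → size S ≡ r → List (PSA Π S))
  (v : (U : Sub n) → size U ≡ b → PSA Π U)
  (v-in-u : (S U : Sub n) (hS : size S ≡ r) (hU : size U ≡ b) (S⊆U : S ⊆ U)
          → Any (λ g → ∀ x (p : x ∈ S) → proj₁ g x p ≡ restrict Π S⊆U (proj₁ (v U hU)) x p) (u S hS))
  (b≤n : b ≤ n) (level≤b : level r ≤ b)
  where

  Assignment : Set
  Assignment = (x : Fin n) → Dom Π x

  _[_≔_] : Assignment → (z : Fin n) → Dom Π z → Assignment
  (α [ z ≔ c ]) x with z ≟ x
  ... | yes refl = c
  ... | no _     = α x

  ≔-same : ∀ α z c → (α [ z ≔ c ]) z ≡ c
  ≔-same α z c with z ≟ z
  ... | yes refl = refl
  ... | no z≢z   = ⊥-elim (z≢z refl)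

  ≔-other : ∀ α {z x} c → z ≢ x → (α [ z ≔ c ]) x ≡ α x
  ≔-other α {z} {x} c z≢x with z ≟ x
  ... | yes refl = ⊥-elim (z≢x refl)
  ... | no _     = refl

  Agrees : Sub n → Assignment → (S : Sub n) → PAssign Π S → Set
  Agrees A α S f = ∀ x (p : x ∈ A) (q : x ∈ S) → f x q ≡ α x

  agrees? : ∀ A α S f → Dec (Agrees A α S f)
  agrees? A α S f = all? λ x → ∀-T? (A x) λ _ → ∀-T? (S x) λ q → f x q ≟ α x

  module _ {α : Assignment} {S : Sub n} {f : PAssign Π S} (z : Fin n) (A : Sub n) {c : Dom Π z} where

    agrees-insert⁻ : ¬ z ∈ A → Agrees (insert z A) (α [ z ≔ c ]) S f → Agrees A α S f
    agrees-insert⁻ z∉A ag x x∈A q = trans (ag x (⊆-insert z A x x∈A) q) (≔-other α c λ { refl → z∉A x∈A })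

    agrees-insert⁺ : ¬ z ∈ A → Agrees A α S f → (∀ q → f z q ≡ c) → Agrees (insert z A) (α [ z ≔ c ]) S f
    agrees-insert⁺ z∉A ag fz≡c x p q with insert⁻ z A p
    ... | inj₁ x∈A = trans (ag x x∈A q) (sym (≔-other α c λ { refl → z∉A x∈A }))
    ... | inj₂ refl = trans (fz≡c q) (sym (≔-same α z c))

    agrees-at : Agrees (insert z A) (α [ z ≔ c ]) S f → (q : z ∈ S) → f z q ≡ c
    agrees-at ag q = trans (ag z (∈-insert z A) q) (≔-same α z c)

  record Cover (A : Sub n) (α : Assignment) (B : Sub n) : Set where
    field
      U      : Sub n
      size-U : size U ≡ b
      A⊆U    : A ⊆ U
      B⊆U    : B ⊆ U
      agrees : Agrees A α U (proj₁ (v U size-U))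

    label : PAssign Π U
    label = proj₁ (v U size-U)

    satisfies : PSatisfies Π U label
    satisfies = proj₂ (v U size-U)

  cover-⊆ : ∀ {A α B B'} → B ⊆ B' → Cover A α B' → Cover A α B
  cover-⊆ B⊆B' C = record
    { U = U ; size-U = size-U ; A⊆U = A⊆U ; B⊆U = λ x p → B⊆U x (B⊆B' x p) ; agrees = agrees }
    where open Cover C

  Dense : ℕ → Sub n → Assignment → Set
  Dense m A α = ∀ B → size B ≤ m → ¬ ¬ Cover A α B

  extending : Sub n → Assignment → (S : Sub n) → size S ≡ r → List (PSA Π S)
  extending A α S hS = filter (agrees? A α S ∘ proj₁) (u S hS)

  FewExtensions : ℕ → Sub n → Assignment → Set
  FewExtensions k A α = ∀ S (hS : size S ≡ r) → A ⊆ S → length (extending A α S hS) ≤ k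

  cover-restriction : ∀ {A α B} (C : Cover A α B) S (hS : size S ≡ r) (S⊆U : S ⊆ Cover.U C)
    → Any (λ g → Agrees A α S (proj₁ g) × (∀ x (p : x ∈ S) → proj₁ g x p ≡ Cover.label C x (S⊆U x p))) (u S hS)
  cover-restriction C S hS S⊆U =
    Any.map (λ g≡ → (λ x p q → trans (g≡ x q) (agrees x p (S⊆U x q))) , g≡) (v-in-u S U hS size-U S⊆U)
    where open Cover C

  size-insert-+ : ∀ (z : Fin n) (A : Sub n) {k} → ¬ z ∈ A → size A + suc k ≡ r → size (insert z A) + k ≡ r
  size-insert-+ z A {k} z∉A |A| = trans (cong (_+ k) (size-insert z A z∉A)) (trans (sym (+-suc (size A) k)) |A|)

  Splits : ℕ → Sub n → Assignment → Set
  Splits m A α = Σ (Fin n) λ z → ¬ z ∈ A × Σ (Dom Π z) λ c₁ → Σ (Dom Π z) λ c₂ → c₁ ≢ c₂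
    × Dense m (insert z A) (α [ z ≔ c₁ ]) × Dense m (insert z A) (α [ z ≔ c₂ ])

  fewer-extensions : ∀ {k A α z c₁ c₂} → ¬ z ∈ A → c₁ ≢ c₂ → size A + suc k ≡ r
    → Dense (level k) (insert z A) (α [ z ≔ c₂ ]) → FewExtensions (suc k) A α
    → FewExtensions k (insert z A) (α [ z ≔ c₁ ])
  fewer-extensions {k} {A} {α} {z} {c₁} {c₂} z∉A c₁≢c₂ |A| dense₂ few S hS A'⊆S =
    decidable-stable (_ ≤? k) shorter
    where
    A' : Sub n
    A' = insert z A
    A⊆S : A ⊆ S
    A⊆S x p = A'⊆S x (⊆-insert z A x p)
    z∈S : z ∈ S
    z∈S = A'⊆S z (∈-insert z A)
    dropped : ∀ (g : PSA Π S) → Agrees A' (α [ z ≔ c₂ ]) S (proj₁ g) → Agrees A α S (proj₁ g) × ¬ Agrees A' (α [ z ≔ c₁ ]) S (proj₁ g)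
    dropped g ag₂ = agrees-insert⁻ z A z∉A ag₂ , λ ag₁ → c₁≢c₂ (trans (sym (agrees-at z A ag₁ z∈S)) (agrees-at z A ag₂ z∈S))
    shorter : ¬ ¬ (length (extending A' (α [ z ≔ c₁ ]) S hS) ≤ k)
    shorter = do
      C ← dense₂ (S ─ A') (≤-trans (≤-reflexive (size-─≡ S A' A'⊆S (trans (size-insert-+ z A z∉A |A|) (sym hS)))) (≤-level k))
      let S⊆U = ─-⊆ (Cover.A⊆U C) (Cover.B⊆U C)
      pure (≤-pred (≤-trans
        (length-filter-< (agrees? A' _ S ∘ proj₁) (agrees? A α S ∘ proj₁) (agrees-insert⁻ z A z∉A)
          (Any.map (λ {g} → dropped g ∘ proj₁) (cover-restriction C S hS S⊆U)))
        (few S hS A⊆S)))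

  Pinned : ℕ → Sub n → Assignment → (z : Fin n) → Dom Π z → Set
  Pinned m A α z c = Σ (Sub n) λ F → size F ≤ m × ((C : Cover A α F) → Σ (z ∈ Cover.U C) λ q → Cover.label C z q ≡ c)

  pinned-∈ : ∀ {m A α z} → z ∈ A → Pinned m A α z (α z)
  pinned-∈ {z = z} z∈A = ∅ , size-∅-≤ {n} , λ C → let open Cover C in
    A⊆U z z∈A , agrees z z∈A (A⊆U z z∈A)

  pinned⇒satisfies : ∀ {m A α} (σ : Assignment) → Dense (2 * m) A α → (∀ x → Pinned m A α x (σ x)) → Satisfies Π σ
  pinned⇒satisfies {m} σ dense pinned = All.tabulate λ {c} c∈Φ → decidable-stable (T? _) do
    let Fx , |Fx| , pin-x = pinned (x c)
        Fy , |Fy| , pin-y = pinned (y c)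
    C ← dense (Fx ∪ Fy) (≤-trans (size-∪ Fx Fy) (≤-trans (+-mono-≤ |Fx| |Fy|) (≤-reflexive (cong (m +_) (sym (+-identityʳ m))))))
    let qx , label≡σx = pin-x (cover-⊆ (⊆-∪ˡ Fx Fy) C)
        qy , label≡σy = pin-y (cover-⊆ (⊆-∪ʳ Fx Fy) C)
    pure (subst₂ (λ a a' → T (R c a a')) label≡σx label≡σy (All.lookup (Cover.satisfies C) c∈Φ qx qy))

  candidates : Sub n → Assignment → (S : Sub n) → size S ≡ r → {z : Fin n} → z ∈ S → List (Dom Π z)
  candidates A α S hS {z} z∈S = map (λ g → proj₁ g z z∈S) (extending A α S hS)

  pinned-by-candidates : ∀ {A α S z} (hS : size S ≡ r) (z∈S : z ∈ S) → A ⊆ S → ¬ z ∈ A → (c₀ : Dom Π z) (F : Sub n)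
    → (∀ {c} → c ∈ˡ candidates A α S hS z∈S → c ≢ c₀ → ¬ Cover (insert z A) (α [ z ≔ c ]) F)
    → (C : Cover A α (S ─ A ∪ F)) → Σ (z ∈ Cover.U C) λ q → Cover.label C z q ≡ c₀
  pinned-by-candidates {A} {α} {S} {z} hS z∈S A⊆S z∉A c₀ F excluded C =
    decide (find (cover-restriction C S hS S⊆U))
    where
    open Cover C
    S⊆U : S ⊆ U
    S⊆U = ─-⊆ A⊆U (λ x p → B⊆U x (⊆-∪ˡ (S ─ A) F x p))
    decide : (∃ λ g → g ∈ˡ u S hS × Agrees A α S (proj₁ g) × (∀ x (p : x ∈ S) → proj₁ g x p ≡ label x (S⊆U x p)))
      → Σ (z ∈ U) λ q → label z q ≡ c₀
    decide (g , g∈u , g-agrees , g≡label) with proj₁ g z z∈S ≟ c₀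
    ... | yes g≡c₀ = S⊆U z z∈S , trans (sym (g≡label z z∈S)) g≡c₀
    ... | no g≢c₀  = ⊥-elim (excluded g∈candidates g≢c₀ cover-by-g)
      where
      g∈candidates : proj₁ g z z∈S ∈ˡ candidates A α S hS z∈S
      g∈candidates = ∈-map⁺ (λ g → proj₁ g z z∈S) (∈-filter⁺ (agrees? A α S ∘ proj₁) g∈u g-agrees)
      cover-by-g : Cover (insert z A) (α [ z ≔ proj₁ g z z∈S ]) F
      cover-by-g = record
        { U = U ; size-U = size-U ; A⊆U = insert-⊆ A⊆U (S⊆U z z∈S) ; B⊆U = λ x p → B⊆U x (⊆-∪ʳ (S ─ A) F x p)
        ; agrees = agrees-insert⁺ z A z∉A agrees λ q →
            trans (cong (label z) (T-irrelevant q (S⊆U z z∈S))) (sym (g≡label z z∈S)) }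

  pinned-∉ : ∀ {k A α z} → ¬ z ∈ A → size A + suc k ≡ r → FewExtensions (suc k) A α → (c₀ : Dom Π z)
    → (∀ c → c ≢ c₀ → ¬ Dense (level k) (insert z A) (α [ z ≔ c ]))
    → ¬ ¬ Pinned (suc k * suc (level k)) A α z c₀
  pinned-∉ {k} {A} {α} {z} z∉A |A| few c₀ sparse =
    pinned-in (superset A' (≤-trans (m≤m+n (size A') k) (≤-reflexive (size-insert-+ z A z∉A |A|))) r≤n)
    where
    r≤n : r ≤ n
    r≤n = ≤-trans (≤-level r) (≤-trans level≤b b≤n)
    A' : Sub n
    A' = insert z A
    Excluded : Dom Π z → Sub n → Set
    Excluded c F = c ≢ c₀ → ¬ Cover A' (α [ z ≔ c ]) F
    excluded-⊆ : ∀ {c F F'} → F ⊆ F' → Excluded c F → Excluded c F'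
    excluded-⊆ F⊆F' ex c≢c₀ C = ex c≢c₀ (cover-⊆ F⊆F' C)
    witness : ∀ c → ¬ ¬ Σ (Sub n) λ F → size F ≤ level k × Excluded c F
    witness c with c ≟ c₀
    ... | yes refl  = pure (∅ , size-∅-≤ {n} , λ c≢c → ⊥-elim (c≢c refl))
    ... | no c≢c₀ = λ none → sparse c c≢c₀ λ B |B| ¬C → none (B , |B| , λ _ → ¬C)
    pinned-in : (Σ (Sub n) λ S → A' ⊆ S × size S ≡ r) → ¬ ¬ Pinned (suc k * suc (level k)) A α z c₀
    pinned-in (S , A'⊆S , hS) = do
      F , |F| , excluded ← ∪-witnesses excluded-⊆ (level k) (candidates A α S hS z∈S) (λ {c} _ → witness c)
      pure (S ─ A ∪ F , bound F |F| , pinned-by-candidates hS z∈S A⊆S z∉A c₀ F excluded)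
      where
      A⊆S : A ⊆ S
      A⊆S x p = A'⊆S x (⊆-insert z A x p)
      z∈S : z ∈ S
      z∈S = A'⊆S z (∈-insert z A)
      few-candidates : length (candidates A α S hS z∈S) ≤ suc k
      few-candidates = ≤-trans (≤-reflexive (length-map _ (extending A α S hS))) (few S hS A⊆S)
      bound : ∀ F → size F ≤ length (candidates A α S hS z∈S) * level k → size (S ─ A ∪ F) ≤ suc k * suc (level k)
      bound F |F| = begin
        size (S ─ A ∪ F)                                    ≤⟨ size-∪ (S ─ A) F ⟩
        size (S ─ A) + size F                               ≤⟨ +-mono-≤ (≤-reflexive (size-─≡ S A A⊆S (trans |A| (sym hS)))) |F| ⟩
        suc k + length (candidates A α S hS z∈S) * level k ≤⟨ +-monoʳ-≤ (suc k) (*-monoˡ-≤ (level k) few-candidates) ⟩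
        suc k + suc k * level k                             ≡⟨ *-suc (suc k) (level k) ⟨
        suc k * suc (level k)                               ∎
        where open ≤-Reasoning

  descend : ∀ k {A α} → size A + k ≡ r → Dense (level k) A α → FewExtensions k A α → ¬ ¬ Σ Assignment (Satisfies Π)
  descend zero {A} {α} |A| dense few = do
    C ← dense ∅ (size-∅-≤ {n})
    ⊥-elim (n≮0 (≤-trans (filter-some (agrees? A α A ∘ proj₁) (Any.map proj₁ (cover-restriction C A hA (Cover.A⊆U C))))
                         (few A hA λ _ p → p)))
    where
    hA : size A ≡ r
    hA = trans (sym (+-identityʳ (size A))) |A|
  descend (suc k) {A} {α} |A| dense few = ¬¬-excluded-middle >>= continue
    where
    pin : ¬ Splits (level k) A α → ∀ z → ¬ ¬ Σ (Dom Π z) (Pinned (suc k * suc (level k)) A α z)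
    pin ¬splits z with T? (A z)
    ... | yes z∈A = pure (α z , pinned-∈ z∈A)
    ... | no z∉A  = do
      c₀ , sparse ← ¬¬-all-but-one (α z) λ c₁≢c₂ dense₁ dense₂ → ¬splits (z , z∉A , _ , _ , c₁≢c₂ , dense₁ , dense₂)
      pinned ← pinned-∉ z∉A |A| few c₀ sparse
      pure (c₀ , pinned)
    continue : Dec (Splits (level k) A α) → ¬ ¬ Σ Assignment (Satisfies Π)
    continue (yes (z , z∉A , c₁ , c₂ , c₁≢c₂ , dense₁ , dense₂)) =
      descend k (size-insert-+ z A z∉A |A|) dense₁ (fewer-extensions z∉A c₁≢c₂ |A| dense₂ few)
    continue (no ¬splits) = do
      pins ← ¬¬-pull (pin ¬splits)
      pure ((λ x → proj₁ (pins x)) , pinned⇒satisfies _ dense (λ x → proj₂ (pins x)))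

  dense-∅ : ∀ {α} → Dense (level r) ∅ α
  dense-∅ B |B| ¬cover with superset B (≤-trans |B| level≤b) b≤n
  ... | U , B⊆U , |U| = ¬cover record { U = U ; size-U = |U| ; A⊆U = λ _ () ; B⊆U = B⊆U ; agrees = λ _ () }

  few-∅ : ∀ {α} → (∀ S hS → length (u S hS) ≤ r) → FewExtensions r ∅ α
  few-∅ |u| S hS _ = ≤-trans (length-filter _ (u S hS)) (|u| S hS)

  -- Domains may be empty a priori; a right vertex containing z supplies a value for it.
  default : 1 ≤ b → Assignment
  default 1≤b z with superset (insert z ∅) (≤-trans (≤-reflexive (trans (size-insert z ∅ λ ()) (cong suc (size-∅ {n})))) 1≤b) b≤n
  ... | U , z⊆U , |U| = proj₁ (v U |U|) z (z⊆U z (∈-insert z ∅))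

lemma3p5 : (r : ℕ) → .{{_ : NonZero r}} → (n : ℕ) → (Π : CSP n)
    → (2 * r) ^ r ≤ n
    → (u : (S : Sub n) → size S ≡ r → List (PSA Π S))
    → ((S : Sub n) (hS : size S ≡ r) → length (u S hS) ≤ r)
    → (v : (U : Sub n) → size U ≡ (2 * r) ^ r → PSA Π U)
    → ((S U : Sub n) (hS : size S ≡ r) (hU : size U ≡ (2 * r) ^ r) (S⊆U : S ⊆ U)
        → Any (λ g → ∀ x (p : x ∈ S) → proj₁ g x p ≡ restrict Π S⊆U (proj₁ (v U hU)) x p) (u S hS))
    → Σ ((x : Fin n) → Dom Π x) (Satisfies Π)
lemma3p5 r n Π b≤n u |u| v v-in-u =
  decidable-stable (satisfiable? Π) (descend r {∅} {default 1≤b} (cong (_+ r) (size-∅ {n})) dense-∅ (few-∅ |u|))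
  where
  open Descent Π r ((2 * r) ^ r) u v v-in-u b≤n (level-bound r)
  1≤b : 1 ≤ (2 * r) ^ r
  1≤b = m^n>0 (2 * r) {{m*n≢0 2 r}} r
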